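{- For all integers $n\ge 1$ and $1\le k\le n$, $$S_q[n,k]=\sum_{w\in\mathcal A(n,k)} q^{A(w)}\,(1+q)^{B(w)} .$$ Consequently, $S_q[n,k]$ evaluated at $q=-1$ equals the number of weakly increasing words in $\mathcal A(n,k)$.
   Context: An RG-word (restricted growth word) of length $n$ with maximum letter $k$ is a word $w=w_1\cdots w_n$ of positive integers with $w_1=1$, $w_i\le \max(w_1,\dots,w_{i-1})+1$ for $2\le i\le n$, and $\max(w_1,\dots,w_n)=k$; $\mathcal R(n,k)$ denotes the set of these. A word $w\in\mathcal R(n,k)$ is allowable if every even letter occurring in $w$ occurs exactly once; $\mathcal A(n,k)$ is the set of allowable words in $\mathcal R(n,k)$. For $w\in\mathcal R(n,k)$ put $m_i=\max(w_1,\dots,w_i)$. Define $A(w)=\sum_{i=2}^n A_i(w)$ and $B(w)=\sum_{i=2}^n B_i(w)$, where $A_i(w)=w_i-1$ if $m_{i-1}\ge w_i$ and $A_i(w)=0$ if $m_{i-1}<w_i$; and $B_i(w)=1$ if $m_{i-1}>w_i$ and $B_i(w)=0$ otherwise. Let $[k]_q=1+q+\cdots+q^{k-1}$. The $q$-Stirling numbers of the second kind are defined by $S_q[n,k]=S_q[n-1,k-1]+[k]_q\,S_q[n-1,k]$ for $1\le k\le n$, with $S_q[n,0]=\delta_{n,0}$, $S_q[0,k]=\delta_{0,k}$, and $S_q[n,k]=0$ for $k>n$. -}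

module Defs where

open import Data.Bool using (Bool; true; false; _∧_; if_then_else_)
open import Data.Nat using (ℕ; zero; suc; _+_; _∸_; _⊔_; _≤ᵇ_; _<ᵇ_; _≡ᵇ_)
open import Data.List using (List; []; _∷_; map; concatMap; filterᵇ; foldr; length; upTo)
open import Algebra.Bundles using (CommutativeRing)

-- Words are lists of natural numbers (letters are positive integers).

wordsOver : ℕ → ℕ → List (List ℕ)
wordsOver zero    m = [] ∷ []
wordsOver (suc n) m = concatMap (λ a → map (a ∷_) (wordsOver n m)) (map suc (upTo m))

-- rgFrom m w : w continues a restricted-growth word whose prefix has
-- maximum m, i.e. every letter x is positive and x ≤ (current max) + 1.
rgFrom : ℕ → List ℕ → Bool
rgFrom m []       = true
rgFrom m (x ∷ xs) = (1 ≤ᵇ x) ∧ (x ≤ᵇ suc m) ∧ rgFrom (m ⊔ x) xs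

isRG : List ℕ → Bool
isRG []       = false
isRG (x ∷ xs) = (x ≡ᵇ 1) ∧ rgFrom x xs

maxLetter : List ℕ → ℕ
maxLetter = foldr _⊔_ 0

isEven : ℕ → Bool
isEven zero          = true
isEven (suc zero)    = false
isEven (suc (suc n)) = isEven n

occurrences : ℕ → List ℕ → ℕ
occurrences x []       = 0
occurrences x (y ∷ ys) = (if y ≡ᵇ x then 1 else 0) + occurrences x ys

allᵇ : (ℕ → Bool) → List ℕ → Bool
allᵇ p []       = true
allᵇ p (x ∷ xs) = p x ∧ allᵇ p xs

isAllowable : List ℕ → Bool
isAllowable w = allᵇ (λ x → if isEven x then (occurrences x w ≡ᵇ 1) else true) w

-- membership test for R(n,k) (length is n by construction of the enumeration)
inR : ℕ → List ℕ → Bool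
inR k w = isRG w ∧ (maxLetter w ≡ᵇ k)

-- 𝓡(n,k) and 𝓐(n,k) as explicit duplicate-free lists
-- (letters of an RG-word of length n are ≤ n).
Rset : ℕ → ℕ → List (List ℕ)
Rset n k = filterᵇ (inR k) (wordsOver n n)

Aset : ℕ → ℕ → List (List ℕ)
Aset n k = filterᵇ isAllowable (Rset n k)

-- Statistics A and B: running maximum m = m_{i-1}, summed over i ≥ 2.
statA-from : ℕ → List ℕ → ℕ
statA-from m []       = 0
statA-from m (x ∷ xs) = (if x ≤ᵇ m then x ∸ 1 else 0) + statA-from (m ⊔ x) xs

statB-from : ℕ → List ℕ → ℕ
statB-from m []       = 0
statB-from m (x ∷ xs) = (if x <ᵇ m then 1 else 0) + statB-from (m ⊔ x) xs

statA : List ℕ → ℕ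
statA []       = 0
statA (x ∷ xs) = statA-from x xs

statB : List ℕ → ℕ
statB []       = 0
statB (x ∷ xs) = statB-from x xs

weaklyIncreasing : List ℕ → Bool
weaklyIncreasing []           = true
weaklyIncreasing (x ∷ [])     = true
weaklyIncreasing (x ∷ y ∷ ys) = (x ≤ᵇ y) ∧ weaklyIncreasing (y ∷ ys)

-- q-analogues, evaluated at an element q of an arbitrary commutative ring.
-- (A polynomial identity in ℤ[q] is the same as its validity for every
--  element of every commutative ring.)

module _ {c ℓ} (R : CommutativeRing c ℓ) where
  open CommutativeRing R using (Carrier; 0#; 1#) renaming (_+_ to _+R_; _*_ to _*R_)

  pow : Carrier → ℕ → Carrier
  pow x zero    = 1#
  pow x (suc n) = x *R pow x n

  qint : Carrier → ℕ → Carrier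
  qint q zero    = 0#
  qint q (suc k) = pow q k +R qint q k

  Sq : Carrier → ℕ → ℕ → Carrier
  Sq q zero    zero    = 1#
  Sq q zero    (suc k) = 0#
  Sq q (suc n) zero    = 0#
  Sq q (suc n) (suc k) = Sq q n k +R qint q (suc k) *R Sq q n (suc k)

  wordSum : Carrier → List (List ℕ) → Carrier
  wordSum q = foldr (λ w acc → pow q (statA w) *R pow (1# +R q) (statB w) +R acc) 0#

module Submission where

-- Read a word letter by letter, keeping the running maximum m, and call a letter a
-- admissible after m if a = m+1, or a ≤ m and a is odd.
-- * A word 1xs is an allowable RG-word iff every letter of xs is admissible: in an
--   RG-word every letter ≤ m has occurred already, so an even letter ≤ m would be a
--   repetition (admissible-characterisation; the proof carries an invariant on the
--   letter counts of the prefix read so far).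
-- * A(w) and B(w) are sums of per-letter contributions, so the weight of a word
--   factors into letter weights (contWeight-cons).
-- * The admissible letters a ≤ m weigh [m]_q in total (admissibleSum).  Hence the
--   total weight of the continuations of length r from maximum m to maximum k obeys
--   the first-step recursion Reach m (r+1) k = Reach (m+1) r k + [m]_q Reach m r k
--   (continuations).  Reach also obeys the last-step recursion defining S_q, so
--   S_q[n,k] = Reach 0 n k (Sq≈Reach); together this is the first claim (Sq≈wordSum).
-- * At q = -1 the factor 1+q kills every letter below the running maximum, while a
--   new maximum weighs 1 and a repeated odd maximum m weighs (-1)^{m-1} = 1.  So an
--   allowable RG-word weighs 1 if it is weakly increasing and 0 otherwise
--   (wordSum-at-minus-one), which gives the second claim.

open import Defs
open import Level using (Level)
open import Data.Bool using (Bool; true; false; _∧_; _∨_; not; if_then_else_; T; T?)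
open import Data.Bool.Properties using (T-∧; T-∨; T-not-≡; not-involutive; ∧-assoc)
open import Data.Nat using (ℕ; zero; suc; _+_; _∸_; _⊔_; _≤ᵇ_; _<ᵇ_; _≡ᵇ_; _≤_; _<_; z≤n; s≤s)
open import Data.Nat.Properties
open import Data.Integer using (ℤ; +_; -_)
import Data.Integer as ℤ
import Data.Integer.Properties as ℤᵖ
open import Data.Integer.Properties using (+-*-commutativeRing)
open import Data.List using (List; []; _∷_; _++_; [_]; map; concatMap; filterᵇ; foldr; length; upTo)
open import Data.List.Properties using (upTo-∷ʳ; map-++)
open import Data.List.Relation.Unary.All as All using (All; []; _∷_)
open import Data.List.Relation.Unary.All.Properties using (all-filter; filter⁺)
open import Data.Product using (_×_; _,_; proj₁; proj₂)
open import Data.Sum using (inj₁; inj₂)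
open import Data.Unit using (tt)
open import Function using (_∘_)
open import Function.Bundles using (Equivalence)
open import Relation.Nullary using (¬_; contradiction; yes; no)
open import Relation.Binary.PropositionalEquality using (_≡_; _≢_; refl; sym; trans; cong; cong₂; subst; module ≡-Reasoning)
open import Algebra.Bundles using (CommutativeRing)
import Algebra.Properties.CommutativeSemigroup as CommSemigroupProperties

true-if : ∀ {b} → T b → b ≡ true
true-if {true} _ = refl

false-if : ∀ {b} → ¬ T b → b ≡ false
false-if {false} _  = refl
false-if {true}  ¬t = contradiction tt ¬t

T-extensional : ∀ {a b} → (T a → T b) → (T b → T a) → a ≡ b
T-extensional {false} {false} _ _ = refl
T-extensional {false} {true}  _ g = contradiction tt g
T-extensional {true}  {false} f _ = contradiction tt f
T-extensional {true}  {true}  _ _ = refl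

∧-split : ∀ {a b} → T (a ∧ b) → T a × T b
∧-split {a} = Equivalence.to (T-∧ {a})

∧-pair : ∀ {a b} → T a → T b → T (a ∧ b)
∧-pair {a} ta tb = Equivalence.from (T-∧ {a}) (ta , tb)

≡ᵇ-false : ∀ {m n} → m ≢ n → (m ≡ᵇ n) ≡ false
≡ᵇ-false {m} {n} m≢n = false-if (m≢n ∘ ≡ᵇ⇒≡ m n)

<ᵇ-true : ∀ {m n} → m < n → (m <ᵇ n) ≡ true
<ᵇ-true = true-if ∘ <⇒<ᵇ

<ᵇ-false : ∀ {m n} → n ≤ m → (m <ᵇ n) ≡ false
<ᵇ-false {m} {n} n≤m = false-if (λ m<ᵇn → <⇒≱ (<ᵇ⇒< m n m<ᵇn) n≤m)

≤ᵇ-true : ∀ {m n} → m ≤ n → (m ≤ᵇ n) ≡ true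
≤ᵇ-true = true-if ∘ ≤⇒≤ᵇ

≤ᵇ-false : ∀ {m n} → n < m → (m ≤ᵇ n) ≡ false
≤ᵇ-false {m} {n} n<m = false-if (λ m≤ᵇn → <⇒≱ n<m (≤ᵇ⇒≤ m n m≤ᵇn))

isEven-suc : ∀ n → isEven (suc n) ≡ not (isEven n)
isEven-suc zero          = refl
isEven-suc (suc zero)    = refl
isEven-suc (suc (suc n)) = isEven-suc n

even-before-odd : ∀ i → ¬ T (isEven (suc i)) → T (isEven i)
even-before-odd zero          _   = tt
even-before-odd (suc zero)    odd = contradiction tt odd
even-before-odd (suc (suc i)) odd = even-before-odd i odd

-- A letter a is admissible after a prefix with maximum m if it is a new
-- maximum, or an odd letter that (in an RG-word) has occurred before.
admissible : ℕ → ℕ → Bool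
admissible m a = (a ≡ᵇ suc m) ∨ ((1 ≤ᵇ a) ∧ (a ≤ᵇ m) ∧ not (isEven a))

data Admissible (m : ℕ) : ℕ → Set where
  fresh  : Admissible m (suc m)
  oldOdd : ∀ {a} → 1 ≤ a → a ≤ m → ¬ T (isEven a) → Admissible m a

admissible-sound : ∀ m a → T (admissible m a) → Admissible m a
admissible-sound m a t with Equivalence.to (T-∨ {a ≡ᵇ suc m}) t
... | inj₁ a≡ᵇ1+m with ≡ᵇ⇒≡ a (suc m) a≡ᵇ1+m
...   | refl = fresh
admissible-sound m a t | inj₂ old with ∧-split {1 ≤ᵇ a} old
...   | 1≤a , t′ with ∧-split {a ≤ᵇ m} t′
...     | a≤m , odd = oldOdd (≤ᵇ⇒≤ 1 a 1≤a) (≤ᵇ⇒≤ a m a≤m)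
                             (λ even → subst T (Equivalence.to T-not-≡ odd) even)

admissible-complete : ∀ {m a} → Admissible m a → T (admissible m a)
admissible-complete {m} fresh =
  Equivalence.from (T-∨ {suc m ≡ᵇ suc m}) (inj₁ (≡⇒≡ᵇ (suc m) (suc m) refl))
admissible-complete {m} {a} (oldOdd 1≤a a≤m odd) =
  Equivalence.from (T-∨ {a ≡ᵇ suc m})
    (inj₂ (∧-pair (≤⇒≤ᵇ 1≤a) (∧-pair (≤⇒≤ᵇ a≤m) (Equivalence.from T-not-≡ (false-if odd)))))

Admissible-bound : ∀ {m a} → Admissible m a → 1 ≤ a × a ≤ suc m
Admissible-bound fresh                = s≤s z≤n , ≤-refl
Admissible-bound (oldOdd 1≤a a≤m _)   = 1≤a , m≤n⇒m≤1+n a≤m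

admissible-old : ∀ {m i} → suc i ≤ m → admissible m (suc i) ≡ isEven i
admissible-old {m} {i} 1+i≤m
  rewrite ≡ᵇ-false (<⇒≢ 1+i≤m) | <ᵇ-true 1+i≤m | isEven-suc i = not-involutive (isEven i)

admissibleFrom : ℕ → List ℕ → Bool
admissibleFrom m []       = true
admissibleFrom m (a ∷ xs) = admissible m a ∧ admissibleFrom (m ⊔ a) xs

hit : ℕ → ℕ → ℕ
hit a x = if a ≡ᵇ x then 1 else 0

hit-self : ∀ a → hit a a ≡ 1
hit-self a rewrite true-if (≡⇒≡ᵇ a a refl) = refl

hit-other : ∀ {a x} → a ≢ x → hit a x ≡ 0
hit-other a≢x rewrite ≡ᵇ-false a≢x = refl

-- c records the letter counts of a prefix with maximum m: each of 1,…,m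
-- occurs and nothing larger does.  This is all we need to know about a prefix.
record Counts (m : ℕ) (c : ℕ → ℕ) : Set where
  field
    seen   : ∀ {x} → 1 ≤ x → x ≤ m → 1 ≤ c x
    unseen : ∀ {x} → m < x → c x ≡ 0
open Counts

push : (ℕ → ℕ) → ℕ → ℕ → ℕ
push c a x = c x + hit a x

push-self : ∀ c a → 1 ≤ push c a a
push-self c a rewrite hit-self a = m≤n+m 1 (c a)

Counts-push : ∀ {m c a} → a ≤ suc m → Counts m c → Counts (m ⊔ a) (push c a)
Counts-push {m} {c} {a} a≤1+m cs .seen {x} 1≤x x≤m⊔a with x ≤? m
... | yes x≤m = ≤-trans (seen cs 1≤x x≤m) (m≤m+n (c x) (hit a x))
... | no  x≰m = subst (λ y → 1 ≤ push c a y) (trans a≡1+m (sym x≡1+m)) (push-self c a)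
  where
  -- a letter beyond m in the new prefix can only be the new maximum m+1 = a
  x≡1+m : x ≡ suc m
  x≡1+m = ≤-antisym (≤-trans x≤m⊔a (⊔-lub (n≤1+n m) a≤1+m)) (≰⇒> x≰m)
  a≡1+m : a ≡ suc m
  a≡1+m = ≤-antisym a≤1+m (≰⇒> (λ a≤m → x≰m (subst (x ≤_) (m≥n⇒m⊔n≡m a≤m) x≤m⊔a)))
Counts-push {m} {c} {a} _ cs .unseen m⊔a<x =
  cong₂ _+_ (unseen cs (m⊔n<o⇒m<o m a m⊔a<x)) (hit-other (<⇒≢ (m⊔n<o⇒n<o m a m⊔a<x)))

hit≤1 : ∀ a x → hit a x ≤ 1
hit≤1 a x with a ≡ᵇ x
... | true  = ≤-refl
... | false = z≤n

EvenOnce : (ℕ → ℕ) → Set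
EvenOnce c = ∀ x → T (isEven x) → c x ≤ 1

push-occurrences : ∀ c a ys x → push c a x + occurrences x ys ≡ c x + occurrences x (a ∷ ys)
push-occurrences c a ys x = +-assoc (c x) (hit a x) (occurrences x ys)

EvenOnce-push : ∀ {m c a} → Counts m c → Admissible m a → EvenOnce c → EvenOnce (push c a)
EvenOnce-push {m} {c} {a} cs view once x even with a ≟ x
... | no a≢x rewrite hit-other a≢x | +-identityʳ (c x) = once x even
EvenOnce-push {m} cs fresh once x even | yes refl
  rewrite unseen cs (n<1+n m) | hit-self (suc m) = ≤-refl
EvenOnce-push cs (oldOdd _ _ odd) once x even | yes refl = contradiction even odd

-- An RG letter after maximum m is admissible unless it is an old even letter,
-- which would then occur twice.
rgLetter-admissible : ∀ {m c a} → Counts m c → 1 ≤ a → a ≤ suc m →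
                      (T (isEven a) → push c a a ≤ 1) → Admissible m a
rgLetter-admissible {m} {c} {a} cs 1≤a a≤1+m once with m≤n⇒m<n∨m≡n a≤1+m
... | inj₂ refl = fresh
... | inj₁ a<1+m = oldOdd 1≤a a≤m (λ even → <⇒≱ repeated (once even))
  where
  a≤m : a ≤ m
  a≤m = ≤-pred a<1+m
  repeated : 1 < push c a a
  repeated = subst (λ h → 2 ≤ c a + h) (sym (hit-self a)) (+-monoˡ-≤ 1 (seen cs 1≤a a≤m))

rgFrom-cons⁻ : ∀ {m a xs} → T (rgFrom m (a ∷ xs)) → 1 ≤ a × a ≤ suc m × T (rgFrom (m ⊔ a) xs)
rgFrom-cons⁻ {m} {a} t =
  let 1≤a , t′ = ∧-split {1 ≤ᵇ a} t
      a≤1+m , rg = ∧-split {a ≤ᵇ suc m} t′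
  in  ≤ᵇ⇒≤ 1 a 1≤a , ≤ᵇ⇒≤ a (suc m) a≤1+m , rg

rgFrom-cons⁺ : ∀ {m a xs} → 1 ≤ a → a ≤ suc m → T (rgFrom (m ⊔ a) xs) → T (rgFrom m (a ∷ xs))
rgFrom-cons⁺ 1≤a a≤1+m rg = ∧-pair (≤⇒≤ᵇ 1≤a) (∧-pair (≤⇒≤ᵇ a≤1+m) rg)

admissible⇒ : ∀ {m c} xs → Counts m c → EvenOnce c → T (admissibleFrom m xs) →
              T (rgFrom m xs) × EvenOnce (λ x → c x + occurrences x xs)
admissible⇒ {c = c} [] _ once _ = tt , λ x even → subst (_≤ 1) (sym (+-identityʳ (c x))) (once x even)
admissible⇒ {m} {c} (a ∷ ys) cs once t =
  let adm , rest  = ∧-split {admissible m a} t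
      view        = admissible-sound m a adm
      1≤a , a≤1+m = Admissible-bound view
      rg , once′  = admissible⇒ ys (Counts-push a≤1+m cs) (EvenOnce-push cs view once) rest
  in  rgFrom-cons⁺ {xs = ys} 1≤a a≤1+m rg , λ x even → subst (_≤ 1) (push-occurrences c a ys x) (once′ x even)

admissible⇐ : ∀ {m c} xs → Counts m c → T (rgFrom m xs) →
              EvenOnce (λ x → c x + occurrences x xs) → T (admissibleFrom m xs)
admissible⇐ [] _ _ _ = tt
admissible⇐ {m} {c} (a ∷ ys) cs rg once =
  let 1≤a , a≤1+m , rg′ = rgFrom-cons⁻ {xs = ys} rg
      once′ : EvenOnce (λ x → push c a x + occurrences x ys)
      once′ x even = subst (_≤ 1) (sym (push-occurrences c a ys x)) (once x even)
      view = rgLetter-admissible cs 1≤a a≤1+m (λ even → ≤-trans (m≤m+n _ _) (once′ a even))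
  in  ∧-pair (admissible-complete view) (admissible⇐ ys (Counts-push a≤1+m cs) rg′ once′)

allᵇ⇒ : ∀ p w {x} → T (allᵇ p w) → 1 ≤ occurrences x w → T (p x)
allᵇ⇒ p (y ∷ ys) {x} t present with y ≟ x
... | yes refl = proj₁ (∧-split {p y} t)
... | no  y≢x  = allᵇ⇒ p ys (proj₂ (∧-split {p y} t))
                         (subst (λ h → 1 ≤ h + occurrences x ys) (hit-other y≢x) present)

⇒allᵇ : ∀ p w → (∀ x → 1 ≤ occurrences x w → T (p x)) → T (allᵇ p w)
⇒allᵇ p []       _ = tt
⇒allᵇ p (y ∷ ys) h =
  ∧-pair (h y (≤-trans (push-self (λ _ → 0) y) (m≤m+n _ _)))
         (⇒allᵇ p ys (λ x present → h x (≤-trans present (m≤n+m _ (hit y x)))))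

T-implication⁻ : ∀ {e b} → T e → T (if e then b else true) → T b
T-implication⁻ {true} _ t = t

T-implication⁺ : ∀ {e b} → (T e → T b) → T (if e then b else true)
T-implication⁺ {true}  f = f tt
T-implication⁺ {false} _ = tt

allowable⇒ : ∀ w → T (isAllowable w) → EvenOnce (λ x → occurrences x w)
allowable⇒ w t x even with 1 ≤? occurrences x w
... | no  absent  = ≤-trans (≤-pred (≰⇒> absent)) z≤n
... | yes present = ≤-reflexive (≡ᵇ⇒≡ _ 1 (T-implication⁻ even (allᵇ⇒ _ w t present)))

allowable⇐ : ∀ w → EvenOnce (λ x → occurrences x w) → T (isAllowable w)
allowable⇐ w once = ⇒allᵇ _ w (λ x present →
  T-implication⁺ (λ even → ≡⇒≡ᵇ _ 1 (≤-antisym (once x even) present)))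

countsOfOne : Counts 1 (hit 1)
countsOfOne .seen {x} 1≤x x≤1 rewrite ≤-antisym x≤1 1≤x = ≤-reflexive (sym (hit-self 1))
countsOfOne .unseen 1<x = hit-other (<⇒≢ 1<x)

admissible-characterisation : ∀ xs → admissibleFrom 1 xs ≡ rgFrom 1 xs ∧ isAllowable (1 ∷ xs)
admissible-characterisation xs = T-extensional
  (λ t → let rg , once = admissible⇒ xs countsOfOne (λ x _ → hit≤1 1 x) t
         in  ∧-pair rg (allowable⇐ (1 ∷ xs) once))
  (λ t → let rg , allowed = ∧-split {rgFrom 1 xs} t
         in  admissible⇐ xs countsOfOne rg (allowable⇒ (1 ∷ xs) allowed))

AllowableRG : List ℕ → Set
AllowableRG w = T (isRG w) × T (isAllowable w)

Aset-allowableRG : ∀ n k → All AllowableRG (Aset n k)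
Aset-allowableRG n k = All.zip (rg , all-filter (T? ∘ isAllowable) (Rset n k))
  where
  rg : All (T ∘ isRG) (Aset n k)
  rg = filter⁺ (T? ∘ isAllowable)
         (All.map (λ {w} inR → proj₁ (∧-split {isRG w} inR)) (all-filter (T? ∘ inR k) (wordsOver n n)))

module Weighted {c ℓ} (R : CommutativeRing c ℓ) (q : CommutativeRing.Carrier R) where
  open CommutativeRing R using (Carrier; 0#; 1#; _≈_; setoid; zeroˡ; zeroʳ; distribˡ; distribʳ)
    renaming (_+_ to _⊕_; _*_ to _⊛_; refl to ≈-refl; sym to ≈-sym; trans to ≈-trans;
              reflexive to ≈-reflexive; +-cong to ⊕-cong; +-congˡ to ⊕-congˡ; +-congʳ to ⊕-congʳ;
              *-cong to ⊛-cong; *-congˡ to ⊛-congˡ; *-congʳ to ⊛-congʳ; +-assoc to ⊕-assoc;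
              +-comm to ⊕-comm; *-assoc to ⊛-assoc; *-comm to ⊛-comm; +-identityˡ to ⊕-identityˡ;
              +-identityʳ to ⊕-identityʳ; *-identityˡ to ⊛-identityˡ; *-identityʳ to ⊛-identityʳ;
              +-commutativeSemigroup to ⊕-commutativeSemigroup;
              *-commutativeSemigroup to ⊛-commutativeSemigroup)
  open CommSemigroupProperties ⊕-commutativeSemigroup using () renaming (interchange to ⊕-interchange)
  open CommSemigroupProperties ⊛-commutativeSemigroup using ()
    renaming (interchange to ⊛-interchange; x∙yz≈y∙xz to ⊛-leftSwap)
  open import Relation.Binary.Reasoning.Setoid setoid

  when : Bool → Carrier → Carrier
  when true  x = x
  when false x = 0#

  when-cong : ∀ b {x y} → x ≈ y → when b x ≈ when b y
  when-cong true  x≈y = x≈y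
  when-cong false _   = ≈-refl

  when-* : ∀ b e x y → when b x ⊛ when e y ≈ when (b ∧ e) (x ⊛ y)
  when-* false e x y = zeroˡ _
  when-* true true x y = ≈-refl
  when-* true false x y = zeroʳ x

  when-complement : ∀ b x → when (not b) x ⊕ when b x ≈ x
  when-complement true  x = ⊕-identityˡ x
  when-complement false x = ⊕-identityʳ x

  -- Finite sums over a list, written as in the definition of wordSum.
  sumL : ∀ {A : Set} → (A → Carrier) → List A → Carrier
  sumL f = foldr (λ x acc → f x ⊕ acc) 0#

  sumL-cong : ∀ {A : Set} {f g : A → Carrier} l → (∀ x → f x ≈ g x) → sumL f l ≈ sumL g l
  sumL-cong []      _ = ≈-refl
  sumL-cong (x ∷ l) h = ⊕-cong (h x) (sumL-cong l h)

  sumL-++ : ∀ {A : Set} (f : A → Carrier) l₁ l₂ → sumL f (l₁ ++ l₂) ≈ sumL f l₁ ⊕ sumL f l₂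
  sumL-++ f []       l₂ = ≈-sym (⊕-identityˡ _)
  sumL-++ f (x ∷ l₁) l₂ = ≈-trans (⊕-congˡ (sumL-++ f l₁ l₂)) (≈-sym (⊕-assoc _ _ _))

  sumL-map : ∀ {A B : Set} (f : B → Carrier) (g : A → B) l → sumL f (map g l) ≈ sumL (λ x → f (g x)) l
  sumL-map f g []      = ≈-refl
  sumL-map f g (x ∷ l) = ⊕-congˡ (sumL-map f g l)

  sumL-concatMap : ∀ {A B : Set} (f : B → Carrier) (g : A → List B) l →
                   sumL f (concatMap g l) ≈ sumL (λ x → sumL f (g x)) l
  sumL-concatMap f g []      = ≈-refl
  sumL-concatMap f g (x ∷ l) = ≈-trans (sumL-++ f (g x) (concatMap g l)) (⊕-congˡ (sumL-concatMap f g l))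

  sumL-scale : ∀ {A : Set} a (f : A → Carrier) l → sumL (λ x → a ⊛ f x) l ≈ a ⊛ sumL f l
  sumL-scale a f []      = ≈-sym (zeroʳ a)
  sumL-scale a f (x ∷ l) = ≈-trans (⊕-congˡ (sumL-scale a f l)) (≈-sym (distribˡ a _ _))

  sumL-filter : ∀ {A : Set} (f : A → Carrier) (p : A → Bool) l →
                sumL f (filterᵇ p l) ≈ sumL (λ x → when (p x) (f x)) l
  sumL-filter f p []      = ≈-refl
  sumL-filter f p (x ∷ l) with p x
  ... | true  = ⊕-congˡ (sumL-filter f p l)
  ... | false = ≈-trans (sumL-filter f p l) (≈-sym (⊕-identityˡ _))

  sumTo : (ℕ → Carrier) → ℕ → Carrier
  sumTo f zero    = 0#
  sumTo f (suc N) = sumTo f N ⊕ f (suc N)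

  sumTo-cong : ∀ {f g} N → (∀ a → a ≤ N → f a ≈ g a) → sumTo f N ≈ sumTo g N
  sumTo-cong zero    _ = ≈-refl
  sumTo-cong (suc N) h = ⊕-cong (sumTo-cong N (λ a a≤N → h a (m≤n⇒m≤1+n a≤N))) (h (suc N) ≤-refl)

  sumTo-scaleʳ : ∀ f a N → sumTo (λ x → f x ⊛ a) N ≈ sumTo f N ⊛ a
  sumTo-scaleʳ f a zero    = ≈-sym (zeroˡ a)
  sumTo-scaleʳ f a (suc N) = ≈-trans (⊕-congʳ (sumTo-scaleʳ f a N)) (≈-sym (distribʳ a _ _))

  sumTo-truncate : ∀ f {j} N → j ≤ N → (∀ a → j < a → f a ≈ 0#) → sumTo f N ≈ sumTo f j
  sumTo-truncate f zero    z≤n _ = ≈-refl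
  sumTo-truncate f (suc N) j≤1+N vanish with m≤n⇒m<n∨m≡n j≤1+N
  ... | inj₂ refl = ≈-refl
  ... | inj₁ j<1+N = ≈-trans (⊕-cong (sumTo-truncate f N (≤-pred j<1+N) vanish) (vanish (suc N) j<1+N))
                            (⊕-identityʳ _)

  sumL-letters : ∀ f N → sumL f (map suc (upTo N)) ≈ sumTo f N
  sumL-letters f zero    = ≈-refl
  sumL-letters f (suc N) = subst (λ l → sumL f l ≈ sumTo f (suc N)) (sym letters-∷ʳ)
    (≈-trans (sumL-++ f (map suc (upTo N)) [ suc N ]) (⊕-cong (sumL-letters f N) (⊕-identityʳ _)))
    where
    letters-∷ʳ : map suc (upTo (suc N)) ≡ map suc (upTo N) ++ [ suc N ]
    letters-∷ʳ = trans (cong (map suc) (sym (upTo-∷ʳ N))) (map-++ suc (upTo N) [ N ])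

  sumL-words : ∀ r N (f : List ℕ → Carrier) →
               sumL f (wordsOver (suc r) N) ≈ sumTo (λ a → sumL (λ xs → f (a ∷ xs)) (wordsOver r N)) N
  sumL-words r N f = begin
    sumL f (wordsOver (suc r) N)
      ≈⟨ sumL-concatMap f _ (map suc (upTo N)) ⟩
    sumL (λ a → sumL f (map (a ∷_) (wordsOver r N))) (map suc (upTo N))
      ≈⟨ sumL-cong (map suc (upTo N)) (λ a → sumL-map f (a ∷_) (wordsOver r N)) ⟩
    sumL (λ a → sumL (λ xs → f (a ∷ xs)) (wordsOver r N)) (map suc (upTo N))
      ≈⟨ sumL-letters _ N ⟩
    sumTo (λ a → sumL (λ xs → f (a ∷ xs)) (wordsOver r N)) N ∎

  pow-+ : ∀ x a b → pow R x (a + b) ≈ pow R x a ⊛ pow R x b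
  pow-+ x zero    b = ≈-sym (⊛-identityˡ _)
  pow-+ x (suc a) b = ≈-trans (⊛-congˡ (pow-+ x a b)) (≈-sym (⊛-assoc _ _ _))

  letterWeight : ℕ → ℕ → Carrier
  letterWeight m a = pow R q (if a ≤ᵇ m then a ∸ 1 else 0) ⊛ pow R (1# ⊕ q) (if a <ᵇ m then 1 else 0)

  tailWeight : ℕ → List ℕ → Carrier
  tailWeight m xs = pow R q (statA-from m xs) ⊛ pow R (1# ⊕ q) (statB-from m xs)

  -- Both statistics are sums of per-letter contributions, so weights multiply.
  tailWeight-cons : ∀ m a xs → tailWeight m (a ∷ xs) ≈ letterWeight m a ⊛ tailWeight (m ⊔ a) xs
  tailWeight-cons m a xs =
    ≈-trans (⊛-cong (pow-+ q (if a ≤ᵇ m then a ∸ 1 else 0) (statA-from (m ⊔ a) xs))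
                    (pow-+ (1# ⊕ q) (if a <ᵇ m then 1 else 0) (statB-from (m ⊔ a) xs)))
            (⊛-interchange _ _ _ _)

  letterWeight-fresh : ∀ m → letterWeight m (suc m) ≈ 1#
  letterWeight-fresh m rewrite <ᵇ-false {m} {m} ≤-refl | <ᵇ-false {suc m} {m} (n≤1+n m) = ⊛-identityˡ 1#

  letterWeight-below : ∀ {m i} → suc i < m → letterWeight m (suc i) ≈ pow R q i ⊛ (1# ⊕ q)
  letterWeight-below {m} {i} 1+i<m
    rewrite <ᵇ-true {i} {m} (<-trans (n<1+n i) 1+i<m) | <ᵇ-true 1+i<m = ⊛-congˡ (⊛-identityʳ _)

  letterWeight-atMax : ∀ i → letterWeight (suc i) (suc i) ≈ pow R q i
  letterWeight-atMax i rewrite <ᵇ-true (n<1+n i) | <ᵇ-false {i} {i} ≤-refl = ⊛-identityʳ _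

  step : ℕ → ℕ → Carrier
  step m a = when (admissible m a) (letterWeight m a)

  step-fresh : ∀ m → step m (suc m) ≈ 1#
  step-fresh m rewrite true-if (admissible-complete (fresh {m})) = letterWeight-fresh m

  step-below : ∀ {m i} → suc i < m → step m (suc i) ≈ when (isEven i) (pow R q i ⊛ (1# ⊕ q))
  step-below {m} {i} 1+i<m rewrite admissible-old {m} {i} (<⇒≤ 1+i<m) =
    when-cong (isEven i) (letterWeight-below 1+i<m)

  step-atMax : ∀ i → step (suc i) (suc i) ≈ when (isEven i) (pow R q i)
  step-atMax i rewrite admissible-old {suc i} {i} ≤-refl = when-cong (isEven i) (letterWeight-atMax i)

  step-beyond : ∀ m a → suc m < a → step m a ≈ 0#
  step-beyond m a 1+m<a with admissible m a in adm
  ... | false = ≈-refl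
  ... | true  = contradiction (proj₂ (Admissible-bound (admissible-sound m a (subst T (sym adm) _))))
                              (<⇒≱ 1+m<a)

  -- Reading the odd letter i+1 < m weighs q^i (1+q) = q^i + q^{i+1}: the partial
  -- sums of the admissible letters telescope.
  telescope : ∀ j b → (qint R q j ⊕ when (not b) (pow R q j)) ⊕ when b (pow R q j ⊛ (1# ⊕ q))
                      ≈ qint R q (suc j) ⊕ when b (pow R q (suc j))
  telescope j false = ⊕-congʳ (⊕-comm _ _)
  telescope j true  = begin
    (qint R q j ⊕ 0#) ⊕ qʲ ⊛ (1# ⊕ q)  ≈⟨ ⊕-cong (⊕-identityʳ _) (distribˡ qʲ 1# q) ⟩
    qint R q j ⊕ (qʲ ⊛ 1# ⊕ qʲ ⊛ q)   ≈⟨ ⊕-congˡ (⊕-cong (⊛-identityʳ qʲ) (⊛-comm qʲ q)) ⟩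
    qint R q j ⊕ (qʲ ⊕ q ⊛ qʲ)         ≈⟨ ⊕-assoc _ _ _ ⟨
    (qint R q j ⊕ qʲ) ⊕ q ⊛ qʲ         ≈⟨ ⊕-congʳ (⊕-comm _ _) ⟩
    (qʲ ⊕ qint R q j) ⊕ q ⊛ qʲ         ∎
    where
    qʲ : Carrier
    qʲ = pow R q j

  lowerSum : ∀ m j → j < m → sumTo (step m) j ≈ qint R q j ⊕ when (not (isEven j)) (pow R q j)
  lowerSum m zero    _     = ≈-sym (⊕-identityˡ 0#)
  lowerSum m (suc j) 1+j<m = begin
    sumTo (step m) j ⊕ step m (suc j)
      ≈⟨ ⊕-cong (lowerSum m j (<-trans (n<1+n j) 1+j<m)) (step-below 1+j<m) ⟩
    (qint R q j ⊕ when (not (isEven j)) (pow R q j)) ⊕ when (isEven j) (pow R q j ⊛ (1# ⊕ q))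
      ≈⟨ telescope j (isEven j) ⟩
    qint R q (suc j) ⊕ when (isEven j) (pow R q (suc j))
      ≡⟨ cong (λ b → qint R q (suc j) ⊕ when b (pow R q (suc j))) (odd-suc j) ⟨
    qint R q (suc j) ⊕ when (not (isEven (suc j))) (pow R q (suc j)) ∎
    where
    odd-suc : ∀ j → not (isEven (suc j)) ≡ isEven j
    odd-suc j rewrite isEven-suc j = not-involutive (isEven j)

  -- The admissible letters a ≤ m weigh [m]_q in total: below m they give
  -- [m-1]_q, plus q^{m-1} if m-1 is odd, and the letter m gives q^{m-1} if m is odd.
  admissibleSum : ∀ m → sumTo (step m) m ≈ qint R q m
  admissibleSum zero    = ≈-refl
  admissibleSum (suc i) = begin
    sumTo (step (suc i)) i ⊕ step (suc i) (suc i)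
      ≈⟨ ⊕-cong (lowerSum (suc i) i (n<1+n i)) (step-atMax i) ⟩
    (qint R q i ⊕ when (not (isEven i)) (pow R q i)) ⊕ when (isEven i) (pow R q i)
      ≈⟨ ⊕-assoc _ _ _ ⟩
    qint R q i ⊕ (when (not (isEven i)) (pow R q i) ⊕ when (isEven i) (pow R q i))
      ≈⟨ ⊕-congˡ (when-complement (isEven i) (pow R q i)) ⟩
    qint R q i ⊕ pow R q i
      ≈⟨ ⊕-comm _ _ ⟩
    qint R q (suc i) ∎

  firstStep : ∀ m (f : ℕ → Carrier) →
              sumTo (λ a → step m a ⊛ f (m ⊔ a)) (suc m) ≈ f (suc m) ⊕ qint R q m ⊛ f m
  firstStep m f = ≈-trans (⊕-cong keep raise) (⊕-comm _ _)
    where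
    keep : sumTo (λ a → step m a ⊛ f (m ⊔ a)) m ≈ qint R q m ⊛ f m
    keep = begin
      sumTo (λ a → step m a ⊛ f (m ⊔ a)) m
        ≈⟨ sumTo-cong m (λ a a≤m → ⊛-congˡ (≈-reflexive (cong f (m≥n⇒m⊔n≡m a≤m)))) ⟩
      sumTo (λ a → step m a ⊛ f m) m
        ≈⟨ sumTo-scaleʳ (step m) (f m) m ⟩
      sumTo (step m) m ⊛ f m
        ≈⟨ ⊛-congʳ (admissibleSum m) ⟩
      qint R q m ⊛ f m ∎
    raise : step m (suc m) ⊛ f (m ⊔ suc m) ≈ f (suc m)
    raise = ≈-trans (⊛-cong (step-fresh m) (≈-reflexive (cong f (m≤n⇒m⊔n≡n (n≤1+n m)))))
                    (⊛-identityˡ _)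

  contWeight : ℕ → List ℕ → ℕ → Carrier
  contWeight m xs k = when (admissibleFrom m xs ∧ (m ⊔ maxLetter xs ≡ᵇ k)) (tailWeight m xs)

  contWeight-[] : ∀ m k → contWeight m [] k ≈ when (m ≡ᵇ k) 1#
  contWeight-[] m k rewrite ⊔-identityʳ m = when-cong (m ≡ᵇ k) (⊛-identityˡ 1#)

  contWeight-cons : ∀ m a xs k → contWeight m (a ∷ xs) k ≈ step m a ⊛ contWeight (m ⊔ a) xs k
  contWeight-cons m a xs k = begin
    when ((adm ∧ rest) ∧ (m ⊔ (a ⊔ maxLetter xs) ≡ᵇ k)) (tailWeight m (a ∷ xs))
      ≈⟨ when-cong ((adm ∧ rest) ∧ (m ⊔ (a ⊔ maxLetter xs) ≡ᵇ k)) (tailWeight-cons m a xs) ⟩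
    when ((adm ∧ rest) ∧ (m ⊔ (a ⊔ maxLetter xs) ≡ᵇ k)) (letterWeight m a ⊛ tailWeight (m ⊔ a) xs)
      ≡⟨ cong (λ b → when b (letterWeight m a ⊛ tailWeight (m ⊔ a) xs)) regroup ⟩
    when (adm ∧ (rest ∧ ((m ⊔ a) ⊔ maxLetter xs ≡ᵇ k))) (letterWeight m a ⊛ tailWeight (m ⊔ a) xs)
      ≈⟨ when-* adm _ _ _ ⟨
    step m a ⊛ contWeight (m ⊔ a) xs k ∎
    where
    adm rest : Bool
    adm  = admissible m a
    rest = admissibleFrom (m ⊔ a) xs
    regroup : (adm ∧ rest) ∧ (m ⊔ (a ⊔ maxLetter xs) ≡ᵇ k)
            ≡ adm ∧ (rest ∧ ((m ⊔ a) ⊔ maxLetter xs ≡ᵇ k))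
    regroup rewrite ⊔-assoc m a (maxLetter xs) = ∧-assoc adm rest _

  -- Reach m r k: total weight of r steps from maximum m to maximum k, a step
  -- either raising the maximum (weight 1) or keeping it (weight [m]_q).
  -- This is the recursion on the first step; S_q is the recursion on the last.
  Reach : ℕ → ℕ → ℕ → Carrier
  Reach m zero    k = when (m ≡ᵇ k) 1#
  Reach m (suc r) k = Reach (suc m) r k ⊕ qint R q m ⊛ Reach m r k

  rearrange : ∀ a b c d x y → (a ⊕ y ⊛ b) ⊕ x ⊛ (c ⊕ y ⊛ d) ≈ (a ⊕ x ⊛ c) ⊕ y ⊛ (b ⊕ x ⊛ d)
  rearrange a b c d x y = begin
    (a ⊕ y ⊛ b) ⊕ x ⊛ (c ⊕ y ⊛ d)          ≈⟨ ⊕-congˡ (distribˡ x c (y ⊛ d)) ⟩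
    (a ⊕ y ⊛ b) ⊕ (x ⊛ c ⊕ x ⊛ (y ⊛ d))    ≈⟨ ⊕-interchange a (y ⊛ b) (x ⊛ c) _ ⟩
    (a ⊕ x ⊛ c) ⊕ (y ⊛ b ⊕ x ⊛ (y ⊛ d))    ≈⟨ ⊕-congˡ (⊕-congˡ (⊛-leftSwap x y d)) ⟩
    (a ⊕ x ⊛ c) ⊕ (y ⊛ b ⊕ y ⊛ (x ⊛ d))    ≈⟨ ⊕-congˡ (distribˡ y b (x ⊛ d)) ⟨
    (a ⊕ x ⊛ c) ⊕ y ⊛ (b ⊕ x ⊛ d)          ∎

  Reach-last : ∀ r m k → Reach m (suc r) (suc k) ≈ Reach m r k ⊕ qint R q (suc k) ⊛ Reach m r (suc k)
  Reach-last zero    m k = ⊕-congˡ (qint-at m (suc k))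
    where
    qint-at : ∀ m j → qint R q m ⊛ when (m ≡ᵇ j) 1# ≈ qint R q j ⊛ when (m ≡ᵇ j) 1#
    qint-at m j with m ≡ᵇ j in m≡ᵇj
    ... | false = ≈-trans (zeroʳ _) (≈-sym (zeroʳ _))
    ... | true rewrite ≡ᵇ⇒≡ m j (subst T (sym m≡ᵇj) _) = ≈-refl
  Reach-last (suc r) m k =
    ≈-trans (⊕-cong (Reach-last r (suc m) k) (⊛-congˡ (Reach-last r m k))) (rearrange _ _ _ _ _ _)

  Reach-to-zero : ∀ m r → Reach (suc m) r 0 ≈ 0#
  Reach-to-zero m zero    = ≈-refl
  Reach-to-zero m (suc r) =
    ≈-trans (⊕-cong (Reach-to-zero (suc m) r) (≈-trans (⊛-congˡ (Reach-to-zero m r)) (zeroʳ _)))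
            (⊕-identityˡ 0#)

  Sq≈Reach : ∀ n k → Sq R q n k ≈ Reach 0 n k
  Sq≈Reach zero    zero    = ≈-refl
  Sq≈Reach zero    (suc k) = ≈-refl
  Sq≈Reach (suc n) zero    = ≈-sym (≈-trans (⊕-cong (Reach-to-zero 0 n) (zeroˡ _)) (⊕-identityˡ 0#))
  Sq≈Reach (suc n) (suc k) =
    ≈-trans (⊕-cong (Sq≈Reach n k) (⊛-congˡ (Sq≈Reach n (suc k)))) (≈-sym (Reach-last n 0 k))

  -- Summing contWeight over all words of length r (alphabet 1..N, large enough
  -- to contain every admissible continuation) gives Reach m r k.
  continuations : ∀ N m r k → m + r ≤ N → sumL (λ xs → contWeight m xs k) (wordsOver r N) ≈ Reach m r k
  continuations N m zero    k _ = ≈-trans (⊕-identityʳ _) (contWeight-[] m k)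
  continuations N m (suc r) k m+1+r≤N = begin
    sumL (λ xs → contWeight m xs k) (wordsOver (suc r) N)
      ≈⟨ sumL-words r N _ ⟩
    sumTo (λ a → sumL (λ xs → contWeight m (a ∷ xs) k) (wordsOver r N)) N
      ≈⟨ sumTo-cong N (λ a _ → factor a) ⟩
    sumTo (λ a → step m a ⊛ rest a) N
      ≈⟨ sumTo-truncate _ N 1+m≤N (λ a 1+m<a → ≈-trans (⊛-congʳ (step-beyond m a 1+m<a)) (zeroˡ _)) ⟩
    sumTo (λ a → step m a ⊛ rest a) (suc m)
      ≈⟨ sumTo-cong (suc m) (λ a a≤1+m → ⊛-congˡ (continuations N (m ⊔ a) r k (bound a a≤1+m))) ⟩
    sumTo (λ a → step m a ⊛ Reach (m ⊔ a) r k) (suc m)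
      ≈⟨ firstStep m (λ m′ → Reach m′ r k) ⟩
    Reach m (suc r) k ∎
    where
    rest : ℕ → Carrier
    rest a = sumL (λ xs → contWeight (m ⊔ a) xs k) (wordsOver r N)
    factor : ∀ a → sumL (λ xs → contWeight m (a ∷ xs) k) (wordsOver r N) ≈ step m a ⊛ rest a
    factor a = ≈-trans (sumL-cong (wordsOver r N) (λ xs → contWeight-cons m a xs k))
                       (sumL-scale (step m a) _ (wordsOver r N))
    1+m≤N : suc m ≤ N
    1+m≤N = ≤-trans (m≤m+n (suc m) r) (subst (_≤ N) (+-suc m r) m+1+r≤N)
    bound : ∀ a → a ≤ suc m → m ⊔ a + r ≤ N
    bound a a≤1+m = ≤-trans (+-monoˡ-≤ r (⊔-lub (n≤1+n m) a≤1+m)) (subst (_≤ N) (+-suc m r) m+1+r≤N)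

  when-nested : ∀ b c e x → when (b ∧ e) (when c x) ≡ when ((b ∧ c) ∧ e) x
  when-nested false c     e     x = refl
  when-nested true  false false x = refl
  when-nested true  false true  x = refl
  when-nested true  true  e     x = refl

  wordWeight : List ℕ → Carrier
  wordWeight w = pow R q (statA w) ⊛ pow R (1# ⊕ q) (statB w)

  allowableWeight : ∀ k → 1 ≤ k → ∀ w →
                    when (inR k w) (when (isAllowable w) (wordWeight w)) ≡ contWeight 0 w k
  allowableWeight (suc k) _ []                 = refl
  allowableWeight k       _ (zero ∷ xs)        = refl
  allowableWeight k       _ (suc (suc a) ∷ xs) = refl
  allowableWeight k       _ (suc zero ∷ xs)    =
    trans
      (when-nested (rgFrom 1 xs) (isAllowable (1 ∷ xs)) e (wordWeight (1 ∷ xs)))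
      (cong (λ b → when (b ∧ e) (wordWeight (1 ∷ xs))) (sym (admissible-characterisation xs)))
    where
    e : Bool
    e = 1 ⊔ maxLetter xs ≡ᵇ k

  wordSum-Aset : ∀ n k → 1 ≤ k → wordSum R q (Aset n k) ≈ sumL (λ w → contWeight 0 w k) (wordsOver n n)
  wordSum-Aset n k 1≤k = begin
    wordSum R q (Aset n k)
      ≈⟨ sumL-filter wordWeight isAllowable (filterᵇ (inR k) (wordsOver n n)) ⟩
    sumL (λ w → when (isAllowable w) (wordWeight w)) (filterᵇ (inR k) (wordsOver n n))
      ≈⟨ sumL-filter _ (inR k) (wordsOver n n) ⟩
    sumL (λ w → when (inR k w) (when (isAllowable w) (wordWeight w))) (wordsOver n n)
      ≈⟨ sumL-cong (wordsOver n n) (λ w → ≈-reflexive (allowableWeight k 1≤k w)) ⟩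
    sumL (λ w → contWeight 0 w k) (wordsOver n n) ∎

  Sq≈wordSum : ∀ n k → 1 ≤ k → Sq R q n k ≈ wordSum R q (Aset n k)
  Sq≈wordSum n k 1≤k = begin
    Sq R q n k                                     ≈⟨ Sq≈Reach n k ⟩
    Reach 0 n k                                    ≈⟨ continuations n 0 n k ≤-refl ⟨
    sumL (λ w → contWeight 0 w k) (wordsOver n n) ≈⟨ wordSum-Aset n k 1≤k ⟨
    wordSum R q (Aset n k)                         ∎

module AtMinusOne where
  open Weighted +-*-commutativeRing (- (+ 1))

  minusOne-even : ∀ i → T (isEven i) → pow +-*-commutativeRing (- (+ 1)) i ≡ + 1
  minusOne-even zero          _    = refl
  minusOne-even (suc (suc i)) even rewrite minusOne-even i even = refl

  -- At q = -1 the factor 1+q vanishes, so reading a letter below the running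
  -- maximum weighs 0; repeating an odd maximum m weighs (-1)^{m-1} = 1, and a
  -- new maximum weighs 1.
  letter-at-minus-one : ∀ {m a} ys → Admissible m a →
                        letterWeight m a ℤ.* when (weaklyIncreasing ((m ⊔ a) ∷ ys)) (+ 1)
                          ≡ when (weaklyIncreasing (m ∷ a ∷ ys)) (+ 1)
  letter-at-minus-one {m} ys fresh
    rewrite m≤n⇒m⊔n≡n (n≤1+n m) | letterWeight-fresh m | ≤ᵇ-true (n≤1+n m) = ℤᵖ.*-identityˡ _
  letter-at-minus-one {m} {suc i} ys (oldOdd _ 1+i≤m odd) with m≤n⇒m<n∨m≡n 1+i≤m
  ... | inj₁ 1+i<m rewrite letterWeight-below 1+i<m | ≤ᵇ-false 1+i<m
                         | ℤᵖ.*-zeroʳ (pow +-*-commutativeRing (- (+ 1)) i)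
    = refl
  ... | inj₂ refl rewrite ⊔-idem (suc i) | letterWeight-atMax i | minusOne-even i (even-before-odd i odd)
                        | ≤ᵇ-true (≤-refl {suc i}) = ℤᵖ.*-identityˡ _

  tailWeight-at-minus-one : ∀ m xs → T (admissibleFrom m xs) →
                            tailWeight m xs ≡ when (weaklyIncreasing (m ∷ xs)) (+ 1)
  tailWeight-at-minus-one m []       _ = refl
  tailWeight-at-minus-one m (a ∷ ys) t =
    let adm , rest = ∧-split {admissible m a} t
    in  begin
      tailWeight m (a ∷ ys)
        ≡⟨ tailWeight-cons m a ys ⟩
      letterWeight m a ℤ.* tailWeight (m ⊔ a) ys
        ≡⟨ cong (letterWeight m a ℤ.*_) (tailWeight-at-minus-one (m ⊔ a) ys rest) ⟩
      letterWeight m a ℤ.* when (weaklyIncreasing ((m ⊔ a) ∷ ys)) (+ 1)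
        ≡⟨ letter-at-minus-one ys (admissible-sound m a adm) ⟩
      when (weaklyIncreasing (m ∷ a ∷ ys)) (+ 1) ∎
    where open ≡-Reasoning

  allowableRG-weight : ∀ w → AllowableRG w → wordWeight w ≡ when (weaklyIncreasing w) (+ 1)
  allowableRG-weight (suc zero ∷ xs) (rg , allowed) =
    tailWeight-at-minus-one 1 xs (subst T (sym (admissible-characterisation xs)) (∧-pair rg allowed))

  -- Summing these weights counts the weakly increasing words; the case split on
  -- weaklyIncreasing w is what lets the filter on the right compute.
  wordSum-at-minus-one : ∀ ws → All AllowableRG ws →
                         wordSum +-*-commutativeRing (- (+ 1)) ws ≡ + length (filterᵇ weaklyIncreasing ws)
  wordSum-at-minus-one []       []             = refl
  wordSum-at-minus-one (w ∷ ws) (good ∷ goods)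
    with weaklyIncreasing w | allowableRG-weight w good
  ... | true  | weight = cong₂ ℤ._+_ weight (wordSum-at-minus-one ws goods)
  ... | false | weight = cong₂ ℤ._+_ weight (wordSum-at-minus-one ws goods)

-- Both claims hold for every k ≥ 1.
theorem3p2 : ∀ {c ℓ : Level} →
             (∀ (R : CommutativeRing c ℓ) (q : CommutativeRing.Carrier R)
                (n k : ℕ) → 1 ≤ n → 1 ≤ k → k ≤ n →
                CommutativeRing._≈_ R (Sq R q n k) (wordSum R q (Aset n k)))
           × (∀ (n k : ℕ) → 1 ≤ n → 1 ≤ k → k ≤ n →
                Sq +-*-commutativeRing (- (+ 1)) n k
                  ≡ + length (filterᵇ weaklyIncreasing (Aset n k)))
theorem3p2 =
    (λ R q n k _ 1≤k _ → Weighted.Sq≈wordSum R q n k 1≤k)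
  , (λ n k _ 1≤k _ →
       trans (Weighted.Sq≈wordSum +-*-commutativeRing (- (+ 1)) n k 1≤k)
             (AtMinusOne.wordSum-at-minus-one (Aset n k) (Aset-allowableRG n k)))
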